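{- Let $(U,\mathcal{F})$ be a standard distributive closure system, let $\mathcal{B}^+$ be a non-empty antichain of $(\mathcal{F},\subseteq)$, let $d\notin U$ be a new element and $U'=U\cup\{d\}$, and let $(U',\mathcal{F}')$ be the closure system whose set of meet-irreducible elements is $\mathrm{Mi}(\mathcal{F}')=\mathcal{B}^+\cup\{M\cup\{d\}: M\in\mathrm{Mi}(\mathcal{F})\}$ (equivalently, $\mathcal{F}'=\{F\in\mathcal{F}: F\subseteq B\text{ for some }B\in\mathcal{B}^+\}\cup\{F\cup\{d\}:F\in\mathcal{F}\}$). Then $(U',\mathcal{F}')$ is a convex geometry; consequently every closed set of $\mathcal{F}'$ has a unique minimal spanning set.
   Context: A closure system $(U,\mathcal{F})$ on a finite set $U$: $U\in\mathcal{F}$ and $\mathcal{F}$ closed under intersection, with closure operator $\phi(A)=\bigcap\{F\in\mathcal{F}:A\subseteq F\}$. Standard: $\phi(\{a\})\setminus\{a\}\in\mathcal{F}$ for all $a$. Distributive: $\mathcal{F}$ is also closed under unions. A closed set $M\neq U$ is meet-irreducible if $M=F_1\cap F_2$ with $F_i\in\mathcal{F}$ implies $F_1=M$ or $F_2=M$. A closure system is a convex geometry if for every closed $F\neq U$ there is $a\notin F$ with $F\cup\{a\}$ closed. A set $K$ is a minimal spanning set of $\phi(K)$ if $\phi(K')\subsetneq\phi(K)$ for all $K'\subsetneq K$; a minimal spanning set of a closed set $F$ is such a $K$ with $\phi(K)=F$. -}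

module Defs where

open import Data.Nat using (ℕ; zero; suc)
open import Data.Bool using (Bool; true; false; T; _∧_)
open import Data.Fin using (Fin)
open import Data.Fin.Subset using (Subset; _∈_; _∉_; _⊆_; _⊂_; _∩_; _∪_; _-_; ⊤; ⁅_⁆)
open import Data.Fin.Subset.Properties using (_⊆?_)
open import Data.Vec using (_∷_; [])
open import Data.List using (List; [_]; _++_; map; foldr; filterᵇ)
open import Data.Bool.ListAction using (any)
open import Data.Product using (_×_; Σ; ∃; ∃!)
open import Relation.Nullary using (¬_; ⌊_⌋)
open import Relation.Binary.PropositionalEquality using (_≡_; _≢_)

Family : ℕ → Set
Family n = Subset n → Bool

_∈ᶠ_ : ∀ {n} → Subset n → Family n → Set
F ∈ᶠ 𝓕 = T (𝓕 F)

allSubsets : ∀ n → List (Subset n)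
allSubsets zero = [ [] ]
allSubsets (suc n) = map (true ∷_) (allSubsets n) ++ map (false ∷_) (allSubsets n)

IsClosureSystem : ∀ {n} → Family n → Set
IsClosureSystem 𝓕 = (⊤ ∈ᶠ 𝓕) × (∀ F G → F ∈ᶠ 𝓕 → G ∈ᶠ 𝓕 → (F ∩ G) ∈ᶠ 𝓕)

φ : ∀ {n} → Family n → Subset n → Subset n
φ {n} 𝓕 A = foldr _∩_ ⊤ (filterᵇ (λ F → 𝓕 F ∧ ⌊ A ⊆? F ⌋) (allSubsets n))

IsStandard : ∀ {n} → Family n → Set
IsStandard {n} 𝓕 = ∀ (a : Fin n) → (φ 𝓕 ⁅ a ⁆ - a) ∈ᶠ 𝓕

IsDistributive : ∀ {n} → Family n → Set
IsDistributive 𝓕 = ∀ F G → F ∈ᶠ 𝓕 → G ∈ᶠ 𝓕 → (F ∪ G) ∈ᶠ 𝓕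

IsNonEmptyAntichain : ∀ {n} → Family n → Family n → Set
IsNonEmptyAntichain 𝓕 𝓑 =
  (∃ λ B → B ∈ᶠ 𝓑)
  × (∀ B → B ∈ᶠ 𝓑 → B ∈ᶠ 𝓕)
  × (∀ B₁ B₂ → B₁ ∈ᶠ 𝓑 → B₂ ∈ᶠ 𝓑 → B₁ ⊆ B₂ → B₁ ≡ B₂)

-- The extended family on U' = U ∪ {d}, realised as Fin (suc n) with d = zero
-- (a subset of U' is  b ∷ F  with b saying whether d belongs to it and F ⊆ U):
--   𝓕' = { F ∈ 𝓕 : F ⊆ B for some B ∈ 𝓑 } ∪ { F ∪ {d} : F ∈ 𝓕 }.
extend : ∀ {n} → Family n → Family n → Family (suc n)
extend 𝓕 𝓑 (true ∷ F) = 𝓕 F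
extend {n} 𝓕 𝓑 (false ∷ F) = 𝓕 F ∧ any (λ B → 𝓑 B ∧ ⌊ F ⊆? B ⌋) (allSubsets n)

IsConvexGeometry : ∀ {n} → Family n → Set
IsConvexGeometry {n} 𝓕 =
  IsClosureSystem 𝓕
  × (∀ F → F ∈ᶠ 𝓕 → F ≢ ⊤ → ∃ λ (a : Fin n) → a ∉ F × ((F ∪ ⁅ a ⁆) ∈ᶠ 𝓕))

IsMinimalSpanning : ∀ {n} → Family n → Subset n → Set
IsMinimalSpanning 𝓕 K = ∀ K' → K' ⊂ K → φ 𝓕 K' ⊂ φ 𝓕 K

IsMinimalSpanningOf : ∀ {n} → Family n → Subset n → Subset n → Set
IsMinimalSpanningOf 𝓕 F K = IsMinimalSpanning 𝓕 K × (φ 𝓕 K ≡ F)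

UniqueMinimalSpanningSets : ∀ {n} → Family n → Set
UniqueMinimalSpanningSets 𝓕 =
  ∀ F → F ∈ᶠ 𝓕 → ∃! _≡_ (IsMinimalSpanningOf 𝓕 F)

-- A standard distributive closure system is a convex geometry: for closed F and a ∉ F,
-- either φ{a} ∖ {a} ⊆ F, and then F ∪ {a} = F ∪ φ{a} is closed, or some b ∉ F lies in
-- φ{a} ∖ {a}, a closed set by standardness, so φ{b} ⊊ φ{a} and we descend to b.
-- Extending by d preserves this: a closed set of 𝓕' avoiding d grows by d, and a closed
-- F ∪ {d} ≠ U' grows by whatever point F grows by in 𝓕.
-- In a convex geometry every closed F is the closure of its extreme points
-- ex F = {x ∈ F : x ∉ φ(F ∖ {x})}: if φ(ex F) ⊊ F, some a ∈ F ∖ φ(ex F) has F ∖ {a} closed,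
-- making a extreme. Every spanning set of F contains ex F, so ex F is its unique minimal one.
module Submission where

open import Defs
open import Data.Nat using (ℕ; suc)
open import Data.Bool using (Bool; true; false; T; _∧_)
open import Data.Bool.Properties using (T-∧; T?)
open import Data.Bool.ListAction using (any)
open import Data.Fin using (Fin; _≟_) renaming (zero to fzero; suc to fsuc)
open import Data.Fin.Subset
open import Data.Fin.Subset.Properties
open import Data.Fin.Subset.Induction using (Acc; acc; ⊂-wellFounded; ⊃-wellFounded)
open import Data.Vec using (_∷_; []; tabulate; here; there)
open import Data.Vec.Properties using (lookup∘tabulate; []=⇒lookup; lookup⇒[]=)
open import Data.List using (List; foldr; filterᵇ; map)
  renaming (_∷_ to _∷ₗ_; [] to []ₗ)
open import Data.List.Membership.Propositional using () renaming (_∈_ to _∈ₗ_)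
open import Data.List.Membership.Propositional.Properties
  using (∈-++⁺ˡ; ∈-++⁺ʳ; ∈-map⁺; ∈-filter⁺; ∈-filter⁻)
open import Data.List.Relation.Unary.Any as Any using () renaming (here to lhere; there to lthere)
open import Data.List.Relation.Unary.Any.Properties using (any⁺; any⁻)
open import Data.Product using (_×_; _,_; proj₁; proj₂; ∃-syntax)
open import Data.Sum using (_⊎_; inj₁; inj₂; [_,_])
open import Function using (_∘_; Equivalence)
open import Relation.Nullary using (Dec; yes; no; ⌊_⌋; does; contradiction; ¬?; _×-dec_)
open import Relation.Nullary.Decidable using (toWitness; fromWitness)
open import Relation.Binary.PropositionalEquality using (_≡_; _≢_; refl; sym; trans; cong; subst)

open Equivalence using (to; from)

module _ {m : ℕ} where

  x∈p─q⁻ : ∀ (p q : Subset m) {x} → x ∈ p ─ q → x ∈ p × x ∉ q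
  x∈p─q⁻ p q x∈ = p─q⊆p p q x∈ , x∉q p q x∈
    where
    x∉q : ∀ {k} (p q : Subset k) {x} → x ∈ p ─ q → x ∉ q
    x∉q (_ ∷ p) (outside ∷ q) here ()
    x∉q (_ ∷ p) (_ ∷ q) (there x∈) (there x∈q) = x∉q p q x∈ x∈q

  x∉p-x : ∀ (p : Subset m) x → x ∉ p - x
  x∉p-x p x x∈ = proj₂ (x∈p─q⁻ p ⁅ x ⁆ x∈) (x∈⁅x⁆ x)

  ⊆-or-witness : ∀ (p q : Subset m) → p ⊆ q ⊎ ∃[ x ] x ∈ p × x ∉ q
  ⊆-or-witness p q with nonempty? (p ─ q)
  ... | yes (x , x∈) = inj₂ (x , x∈p─q⁻ p q x∈)
  ... | no p─q-empty = inj₁ p⊆q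
    where
    p⊆q : p ⊆ q
    p⊆q {x} x∈p with x ∈? q
    ... | yes x∈q = x∈q
    ... | no x∉q = contradiction (x , x∈p∧x∉q⇒x∈p─q x∈p x∉q) p─q-empty

  ≢⊤⇒witness : ∀ {p : Subset m} → p ≢ ⊤ → ∃[ x ] x ∉ p
  ≢⊤⇒witness {p} p≢⊤ with ⊆-or-witness ⊤ p
  ... | inj₁ ⊤⊆p = contradiction (⊆-antisym ⊆⊤ ⊤⊆p) p≢⊤
  ... | inj₂ (x , _ , x∉p) = x , x∉p

  ∪-lub : ∀ {p q r : Subset m} → p ⊆ r → q ⊆ r → p ∪ q ⊆ r
  ∪-lub {p} {q} p⊆r q⊆r = [ p⊆r , q⊆r ] ∘ x∈p∪q⁻ p q

  x∈p⇒⁅x⁆⊆p : ∀ {p : Subset m} {x} → x ∈ p → ⁅ x ⁆ ⊆ p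
  x∈p⇒⁅x⁆⊆p {p} {x} x∈p y∈ = subst (_∈ p) (sym (x∈⁅y⁆⇒x≡y x y∈)) x∈p

  x∉p⇒p⊂p∪⁅x⁆ : ∀ {p : Subset m} {x} → x ∉ p → p ⊂ p ∪ ⁅ x ⁆
  x∉p⇒p⊂p∪⁅x⁆ {p} {x} x∉p = p⊆p∪q ⁅ x ⁆ , x , q⊆p∪q p ⁅ x ⁆ (x∈⁅x⁆ x) , x∉p

  x∉p∪⁅y⁆ : ∀ {p : Subset m} {x y} → x ∉ p → x ≢ y → x ∉ p ∪ ⁅ y ⁆
  x∉p∪⁅y⁆ {p} {x} {y} x∉p x≢y = [ x∉p , x≢y ∘ x∈⁅y⁆⇒x≡y y ] ∘ x∈p∪q⁻ p ⁅ y ⁆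

  p⊆q∧x∉p⇒p⊆q-x : ∀ {p q : Subset m} {x} → p ⊆ q → x ∉ p → p ⊆ q - x
  p⊆q∧x∉p⇒p⊆q-x p⊆q x∉p y∈p = x∈p∧x≢y⇒x∈p-y (p⊆q y∈p) (λ { refl → x∉p y∈p })

  p⊆q⇒p∩q≡p : ∀ {p q : Subset m} → p ⊆ q → p ∩ q ≡ p
  p⊆q⇒p∩q≡p {p} {q} p⊆q = ⊆-antisym (p∩q⊆p p q) (λ x∈p → x∈p∩q⁺ (x∈p , p⊆q x∈p))

  x∉q⇒⁅x⁆∩q≡⊥ : ∀ {q : Subset m} {x} → x ∉ q → ⁅ x ⁆ ∩ q ≡ ⊥
  x∉q⇒⁅x⁆∩q≡⊥ {q} {x} x∉q = ⊆-antisym y∉ ⊥⊆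
    where
    y∉ : ⁅ x ⁆ ∩ q ⊆ ⊥
    y∉ {y} y∈ with x∈p∩q⁻ ⁅ x ⁆ q y∈
    ... | y∈⁅x⁆ , y∈q = contradiction (subst (_∈ q) (x∈⁅y⁆⇒x≡y x y∈⁅x⁆) y∈q) x∉q

  p∪⁅x⁆∩q≡p∩q∪⁅x⁆ : ∀ (p : Subset m) {q x} → x ∈ q → (p ∪ ⁅ x ⁆) ∩ q ≡ (p ∩ q) ∪ ⁅ x ⁆
  p∪⁅x⁆∩q≡p∩q∪⁅x⁆ p {q} {x} x∈q =
    trans (∩-distribʳ-∪ q p ⁅ x ⁆) (cong (p ∩ q ∪_) (p⊆q⇒p∩q≡p (x∈p⇒⁅x⁆⊆p x∈q)))

  p∪⁅x⁆∩q≡p∩q : ∀ (p : Subset m) {q x} → x ∉ q → (p ∪ ⁅ x ⁆) ∩ q ≡ p ∩ q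
  p∪⁅x⁆∩q≡p∩q p {q} {x} x∉q =
    trans (∩-distribʳ-∪ q p ⁅ x ⁆) (trans (cong (p ∩ q ∪_) (x∉q⇒⁅x⁆∩q≡⊥ x∉q)) (∪-identityʳ (p ∩ q)))

  q⊆p∪⁅x⁆⇒q-x≡p : ∀ {p q : Subset m} {x} → p ⊆ q → x ∉ p → q ⊆ p ∪ ⁅ x ⁆ → q - x ≡ p
  q⊆p∪⁅x⁆⇒q-x≡p {p} {q} {x} p⊆q x∉p q⊆p∪⁅x⁆ = ⊆-antisym q-x⊆p (p⊆q∧x∉p⇒p⊆q-x p⊆q x∉p)
    where
    q-x⊆p : q - x ⊆ p
    q-x⊆p y∈ with x∈p─q⁻ q ⁅ x ⁆ y∈
    ... | y∈q , y∉⁅x⁆ = [ (λ y∈p → y∈p) , (λ y∈⁅x⁆ → contradiction y∈⁅x⁆ y∉⁅x⁆) ]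
                          (x∈p∪q⁻ p ⁅ x ⁆ (q⊆p∪⁅x⁆ y∈q))

  select : {P : Fin m → Set} → (∀ x → Dec (P x)) → Subset m
  select P? = tabulate (λ x → does (P? x))

  module _ {P : Fin m → Set} (P? : ∀ x → Dec (P x)) where

    ∈-select⁻ : ∀ {x} → x ∈ select P? → P x
    ∈-select⁻ {x} x∈ with P? x | trans (sym (lookup∘tabulate (does ∘ P?) x)) ([]=⇒lookup x∈)
    ... | yes Px | _ = Px

    ∈-select⁺ : ∀ {x} → P x → x ∈ select P?
    ∈-select⁺ {x} Px = lookup⇒[]= x (select P?) (trans (lookup∘tabulate (does ∘ P?) x) does≡true)
      where
      does≡true : does (P? x) ≡ true
      does≡true with P? x
      ... | yes _ = refl
      ... | no ¬Px = contradiction Px ¬Px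

∈-allSubsets : ∀ {m} (A : Subset m) → A ∈ₗ allSubsets m
∈-allSubsets [] = lhere refl
∈-allSubsets {suc m} (true ∷ A) = ∈-++⁺ˡ (∈-map⁺ (true ∷_) (∈-allSubsets A))
∈-allSubsets {suc m} (false ∷ A) =
  ∈-++⁺ʳ (map (true ∷_) (allSubsets m)) (∈-map⁺ (false ∷_) (∈-allSubsets A))

module _ {m : ℕ} where

  foldr-∩-lowerBound : ∀ (Fs : List (Subset m)) {F} → F ∈ₗ Fs → foldr _∩_ ⊤ Fs ⊆ F
  foldr-∩-lowerBound (G ∷ₗ Fs) (lhere refl) x∈ = proj₁ (x∈p∩q⁻ G _ x∈)
  foldr-∩-lowerBound (G ∷ₗ Fs) (lthere F∈) x∈ = foldr-∩-lowerBound Fs F∈ (proj₂ (x∈p∩q⁻ G _ x∈))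

  foldr-∩-greatest : ∀ (Fs : List (Subset m)) {A} → (∀ {F} → F ∈ₗ Fs → A ⊆ F) → A ⊆ foldr _∩_ ⊤ Fs
  foldr-∩-greatest []ₗ A⊆ x∈ = ∈⊤
  foldr-∩-greatest (G ∷ₗ Fs) A⊆ x∈ =
    x∈p∩q⁺ (A⊆ (lhere refl) x∈ , foldr-∩-greatest Fs (A⊆ ∘ lthere) x∈)

  foldr-∩-closed : ∀ (𝓖 : Family m) → IsClosureSystem 𝓖 → (Fs : List (Subset m))
                 → (∀ {F} → F ∈ₗ Fs → F ∈ᶠ 𝓖) → foldr _∩_ ⊤ Fs ∈ᶠ 𝓖
  foldr-∩-closed 𝓖 (⊤∈ , _) []ₗ Fs⊆ = ⊤∈
  foldr-∩-closed 𝓖 cs@(_ , ∩-closed) (G ∷ₗ Fs) Fs⊆ =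
    ∩-closed G _ (Fs⊆ (lhere refl)) (foldr-∩-closed 𝓖 cs Fs (Fs⊆ ∘ lthere))

module _ {m : ℕ} (𝓖 : Family m) where

  private
    closedAbove : Subset m → Subset m → Bool
    closedAbove A F = 𝓖 F ∧ ⌊ A ⊆? F ⌋

    ∈-closedAbove⁻ : ∀ {A F} → F ∈ₗ filterᵇ (closedAbove A) (allSubsets m) → F ∈ᶠ 𝓖 × A ⊆ F
    ∈-closedAbove⁻ {A} {F} F∈
      with to (T-∧ {𝓖 F}) (proj₂ (∈-filter⁻ (T? ∘ closedAbove A) {xs = allSubsets m} F∈))
    ... | F∈𝓖 , A⊆F = F∈𝓖 , toWitness A⊆F

  φ-extensive : ∀ A → A ⊆ φ 𝓖 A
  φ-extensive A = foldr-∩-greatest _ (proj₂ ∘ ∈-closedAbove⁻)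

  φ-least : ∀ {A F} → F ∈ᶠ 𝓖 → A ⊆ F → φ 𝓖 A ⊆ F
  φ-least {A} {F} F∈ A⊆F = foldr-∩-lowerBound _
    (∈-filter⁺ (T? ∘ closedAbove A) (∈-allSubsets F)
               (from (T-∧ {𝓖 F}) (F∈ , fromWitness (λ {x} → A⊆F {x}))))

  φ-closed : IsClosureSystem 𝓖 → ∀ A → φ 𝓖 A ∈ᶠ 𝓖
  φ-closed cs A =
    foldr-∩-closed 𝓖 cs (filterᵇ (closedAbove A) (allSubsets m)) (proj₁ ∘ ∈-closedAbove⁻)

  φ-monotone : ∀ {A B} → A ⊆ B → φ 𝓖 A ⊆ φ 𝓖 B
  φ-monotone A⊆B = foldr-∩-greatest _ λ F∈ → let F∈𝓖 , B⊆F = ∈-closedAbove⁻ F∈ in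
    φ-least F∈𝓖 (B⊆F ∘ A⊆B)

  φ-fixed : ∀ {F} → F ∈ᶠ 𝓖 → φ 𝓖 F ≡ F
  φ-fixed {F} F∈ = ⊆-antisym (φ-least F∈ (λ x∈ → x∈)) (φ-extensive F)

-- Extreme points and minimal spanning sets

module _ {m : ℕ} (𝓖 : Family m) where

  IsExtremePoint : Subset m → Fin m → Set
  IsExtremePoint F x = x ∈ F × x ∉ φ 𝓖 (F - x)

  isExtremePoint? : ∀ F x → Dec (IsExtremePoint F x)
  isExtremePoint? F x = x ∈? F ×-dec ¬? (x ∈? φ 𝓖 (F - x))

  extremePoints : Subset m → Subset m
  extremePoints F = select (isExtremePoint? F)

  extremePoints⊆ : ∀ F → extremePoints F ⊆ F
  extremePoints⊆ F = proj₁ ∘ ∈-select⁻ (isExtremePoint? F)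

  extremePoints⊆spanning : ∀ {F K} → φ 𝓖 K ≡ F → extremePoints F ⊆ K
  extremePoints⊆spanning {F} {K} φK≡F {x} x∈ex with x ∈? K | ∈-select⁻ (isExtremePoint? F) x∈ex
  ... | yes x∈K | _ = x∈K
  ... | no x∉K | x∈F , x∉φ[F-x] =
    contradiction (φ-monotone 𝓖 K⊆F-x (subst (x ∈_) (sym φK≡F) x∈F)) x∉φ[F-x]
    where
    K⊆F-x : K ⊆ F - x
    K⊆F-x = p⊆q∧x∉p⇒p⊆q-x (subst (K ⊆_) φK≡F (φ-extensive 𝓖 K)) x∉K

  extremePoints-isMinimalSpanning : ∀ F → IsMinimalSpanning 𝓖 (extremePoints F)
  extremePoints-isMinimalSpanning F K (K⊆ex , x , x∈ex , x∉K) =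
    φ-monotone 𝓖 K⊆ex , x , φ-extensive 𝓖 _ x∈ex , x∉φK
    where
    x∉φK : x ∉ φ 𝓖 K
    x∉φK = proj₂ (∈-select⁻ (isExtremePoint? F) x∈ex)
         ∘ φ-monotone 𝓖 (p⊆q∧x∉p⇒p⊆q-x (extremePoints⊆ F ∘ K⊆ex) x∉K)

-- Convex geometries

module ConvexGeometry {m : ℕ} (𝓖 : Family m) (cg : IsConvexGeometry 𝓖) where

  private
    cs = proj₁ cg
    ∩-closed = proj₂ cs
    addable = proj₂ cg

  -- Adding points to H one at a time, the first one to land in F extends H ∩ F.
  addable-within : ∀ {H F b} → Acc _⊃_ H → H ∈ᶠ 𝓖 → F ∈ᶠ 𝓖 → b ∈ F → b ∉ H
                 → ∃[ c ] c ∈ F × c ∉ H × ((H ∩ F) ∪ ⁅ c ⁆) ∈ᶠ 𝓖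
  addable-within {H} {F} {b} (acc rs) H∈ F∈ b∈F b∉H
    with addable H H∈ (λ H≡⊤ → b∉H (subst (b ∈_) (sym H≡⊤) ∈⊤))
  ... | c , c∉H , H∪c∈ with c ∈? F
  ... | yes c∈F = c , c∈F , c∉H , subst (_∈ᶠ 𝓖) (p∪⁅x⁆∩q≡p∩q∪⁅x⁆ H c∈F) (∩-closed _ F H∪c∈ F∈)
  ... | no c∉F
    with addable-within (rs (x∉p⇒p⊂p∪⁅x⁆ c∉H)) H∪c∈ F∈ b∈F (x∉p∪⁅y⁆ b∉H λ { refl → c∉F b∈F })
  ... | c′ , c′∈F , c′∉H∪c , X∈ =
    c′ , c′∈F , c′∉H∪c ∘ p⊆p∪q ⁅ c ⁆ , subst (λ X → (X ∪ ⁅ c′ ⁆) ∈ᶠ 𝓖) (p∪⁅x⁆∩q≡p∩q H c∉F) X∈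

  addable-below : ∀ {G F b} → G ∈ᶠ 𝓖 → F ∈ᶠ 𝓖 → G ⊆ F → b ∈ F → b ∉ G
                → ∃[ c ] c ∈ F × c ∉ G × (G ∪ ⁅ c ⁆) ∈ᶠ 𝓖
  addable-below {G} G∈ F∈ G⊆F b∈F b∉G with addable-within (⊃-wellFounded G) G∈ F∈ b∈F b∉G
  ... | c , c∈F , c∉G , X∈ = c , c∈F , c∉G , subst (λ X → (X ∪ ⁅ c ⁆) ∈ᶠ 𝓖) (p⊆q⇒p∩q≡p G⊆F) X∈

  -- Grow G inside F one point at a time; the last point added is removable from F.
  removable : ∀ {G F b} → Acc _⊃_ G → G ∈ᶠ 𝓖 → F ∈ᶠ 𝓖 → G ⊆ F → b ∈ F → b ∉ G
            → ∃[ a ] a ∈ F × a ∉ G × (F - a) ∈ᶠ 𝓖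
  removable {G} {F} (acc rs) G∈ F∈ G⊆F b∈F b∉G with addable-below G∈ F∈ G⊆F b∈F b∉G
  ... | c , c∈F , c∉G , G∪c∈ with ⊆-or-witness F (G ∪ ⁅ c ⁆)
  ... | inj₁ F⊆G∪c = c , c∈F , c∉G , subst (_∈ᶠ 𝓖) (sym (q⊆p∪⁅x⁆⇒q-x≡p G⊆F c∉G F⊆G∪c)) G∈
  ... | inj₂ (x , x∈F , x∉G∪c)
    with removable (rs (x∉p⇒p⊂p∪⁅x⁆ c∉G)) G∪c∈ F∈ (∪-lub G⊆F (x∈p⇒⁅x⁆⊆p c∈F)) x∈F x∉G∪c
  ... | a , a∈F , a∉G∪c , F-a∈ = a , a∈F , a∉G∪c ∘ p⊆p∪q ⁅ c ⁆ , F-a∈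

  φ-extremePoints : ∀ {F} → F ∈ᶠ 𝓖 → φ 𝓖 (extremePoints 𝓖 F) ≡ F
  φ-extremePoints {F} F∈ = ⊆-antisym G⊆F F⊆G
    where
    G = φ 𝓖 (extremePoints 𝓖 F)
    G⊆F : G ⊆ F
    G⊆F = φ-least 𝓖 F∈ (extremePoints⊆ 𝓖 F)
    F⊆G : F ⊆ G
    F⊆G {x} x∈F with x ∈? G
    ... | yes x∈G = x∈G
    ... | no x∉G with removable (⊃-wellFounded G) (φ-closed 𝓖 cs _) F∈ G⊆F x∈F x∉G
    ... | a , a∈F , a∉G , F-a∈ =
      contradiction (φ-extensive 𝓖 _ (∈-select⁺ (isExtremePoint? 𝓖 F) (a∈F , a∉φ[F-a]))) a∉G
      where
      a∉φ[F-a] : a ∉ φ 𝓖 (F - a)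
      a∉φ[F-a] = x∉p-x F a ∘ subst (a ∈_) (φ-fixed 𝓖 F-a∈)

  uniqueMinimalSpanningSets : UniqueMinimalSpanningSets 𝓖
  uniqueMinimalSpanningSets F F∈ =
    extremePoints 𝓖 F , (extremePoints-isMinimalSpanning 𝓖 F , φ-extremePoints F∈) , unique
    where
    unique : ∀ {K} → IsMinimalSpanningOf 𝓖 F K → extremePoints 𝓖 F ≡ K
    unique {K} (K-minimal , φK≡F) = ⊆-antisym ex⊆K K⊆ex
      where
      ex⊆K = extremePoints⊆spanning 𝓖 φK≡F
      K⊆ex : K ⊆ extremePoints 𝓖 F
      K⊆ex {x} x∈K with x ∈? extremePoints 𝓖 F
      ... | yes x∈ex = x∈ex
      ... | no x∉ex = contradiction (K-minimal _ (ex⊆K , x , x∈K , x∉ex))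
                                    (⊂-irref (trans (φ-extremePoints F∈) (sym φK≡F)))

-- Standard distributive closure systems

module _ {n : ℕ} {𝓕 : Family n} (cs : IsClosureSystem 𝓕) (standard : IsStandard 𝓕)
         (distributive : IsDistributive 𝓕) where

  addable-descending : ∀ {F a} → Acc _⊂_ (φ 𝓕 ⁅ a ⁆) → F ∈ᶠ 𝓕 → a ∉ F
                     → ∃[ c ] c ∉ F × (F ∪ ⁅ c ⁆) ∈ᶠ 𝓕
  addable-descending {F} {a} (acc rs) F∈ a∉F with ⊆-or-witness (φ 𝓕 ⁅ a ⁆ - a) F
  ... | inj₁ φa-a⊆F = a , a∉F , subst (_∈ᶠ 𝓕) F∪φa≡F∪a (distributive F _ F∈ (φ-closed 𝓕 cs ⁅ a ⁆))
    where
    φa⊆F∪a : φ 𝓕 ⁅ a ⁆ ⊆ F ∪ ⁅ a ⁆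
    φa⊆F∪a {x} x∈ with x ≟ a
    ... | yes refl = q⊆p∪q F ⁅ a ⁆ (x∈⁅x⁆ a)
    ... | no x≢a = p⊆p∪q ⁅ a ⁆ (φa-a⊆F (x∈p∧x≢y⇒x∈p-y x∈ x≢a))
    F∪φa≡F∪a : F ∪ φ 𝓕 ⁅ a ⁆ ≡ F ∪ ⁅ a ⁆
    F∪φa≡F∪a = ⊆-antisym (∪-lub (p⊆p∪q ⁅ a ⁆) φa⊆F∪a)
                         (∪-lub (p⊆p∪q _) (q⊆p∪q F _ ∘ φ-extensive 𝓕 ⁅ a ⁆))
  ... | inj₂ (b , b∈φa-a , b∉F) = addable-descending (rs φb⊂φa) F∈ b∉F
    where
    φb⊂φa : φ 𝓕 ⁅ b ⁆ ⊂ φ 𝓕 ⁅ a ⁆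
    φb⊂φa = ⊆-⊂-trans (φ-least 𝓕 (standard a) (x∈p⇒⁅x⁆⊆p b∈φa-a))
                      (x∈p⇒p-x⊂p (φ-extensive 𝓕 ⁅ a ⁆ (x∈⁅x⁆ a)))

  standard∧distributive⇒convexGeometry : IsConvexGeometry 𝓕
  standard∧distributive⇒convexGeometry = cs , addable
    where
    addable : ∀ F → F ∈ᶠ 𝓕 → F ≢ ⊤ → ∃[ c ] c ∉ F × (F ∪ ⁅ c ⁆) ∈ᶠ 𝓕
    addable F F∈ F≢⊤ with ≢⊤⇒witness F≢⊤
    ... | a , a∉F = addable-descending (⊂-wellFounded _) F∈ a∉F

-- The one-point extension

module _ {n : ℕ} (𝓕 𝓑 : Family n) where

  private
    Below : Subset n → Set
    Below F = T (any (λ B → 𝓑 B ∧ ⌊ F ⊆? B ⌋) (allSubsets n))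

    Below-antitone : ∀ {F G} → F ⊆ G → Below G → Below F
    Below-antitone {F} {G} F⊆G =
      any⁺ (λ B → 𝓑 B ∧ ⌊ F ⊆? B ⌋) ∘ Any.map below ∘ any⁻ (λ B → 𝓑 B ∧ ⌊ G ⊆? B ⌋) (allSubsets n)
      where
      below : ∀ {B} → T (𝓑 B ∧ ⌊ G ⊆? B ⌋) → T (𝓑 B ∧ ⌊ F ⊆? B ⌋)
      below {B} t with to (T-∧ {𝓑 B}) t
      ... | B∈ , G⊆B = from (T-∧ {𝓑 B}) (B∈ , fromWitness (λ {x} → toWitness G⊆B ∘ F⊆G {x}))

    extend-false⁻ : ∀ {F} → (false ∷ F) ∈ᶠ extend 𝓕 𝓑 → F ∈ᶠ 𝓕 × Below F
    extend-false⁻ {F} = to (T-∧ {𝓕 F})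

    extend-false⁺ : ∀ {F} → F ∈ᶠ 𝓕 → Below F → (false ∷ F) ∈ᶠ extend 𝓕 𝓑
    extend-false⁺ {F} F∈ F-below = from (T-∧ {𝓕 F}) (F∈ , F-below)

  extend-isClosureSystem : IsClosureSystem 𝓕 → IsClosureSystem (extend 𝓕 𝓑)
  extend-isClosureSystem (⊤∈ , ∩-closed) = ⊤∈ , ∩-closed′
    where
    ∩-closed′ : ∀ F G → F ∈ᶠ extend 𝓕 𝓑 → G ∈ᶠ extend 𝓕 𝓑 → (F ∩ G) ∈ᶠ extend 𝓕 𝓑
    ∩-closed′ (true ∷ F) (true ∷ G) F∈ G∈ = ∩-closed F G F∈ G∈
    ∩-closed′ (true ∷ F) (false ∷ G) F∈ G∈ =
      let G∈𝓕 , G-below = extend-false⁻ G∈ in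
      extend-false⁺ (∩-closed F G F∈ G∈𝓕) (Below-antitone (p∩q⊆q F G) G-below)
    ∩-closed′ (false ∷ F) (true ∷ G) F∈ G∈ =
      let F∈𝓕 , F-below = extend-false⁻ F∈ in
      extend-false⁺ (∩-closed F G F∈𝓕 G∈) (Below-antitone (p∩q⊆p F G) F-below)
    ∩-closed′ (false ∷ F) (false ∷ G) F∈ G∈ =
      let F∈𝓕 , F-below = extend-false⁻ F∈ in
      extend-false⁺ (∩-closed F G F∈𝓕 (proj₁ (extend-false⁻ G∈)))
                    (Below-antitone (p∩q⊆p F G) F-below)

  extend-isConvexGeometry : IsConvexGeometry 𝓕 → IsConvexGeometry (extend 𝓕 𝓑)
  extend-isConvexGeometry (cs , addable) = extend-isClosureSystem cs , addable′
    where
    addable′ : ∀ F → F ∈ᶠ extend 𝓕 𝓑 → F ≢ ⊤ → ∃[ c ] c ∉ F × (F ∪ ⁅ c ⁆) ∈ᶠ extend 𝓕 𝓑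
    addable′ (false ∷ F) F∈ _ =
      fzero , (λ ()) , subst (_∈ᶠ 𝓕) (sym (∪-identityʳ F)) (proj₁ (extend-false⁻ F∈))
    addable′ (true ∷ F) F∈ F≢⊤ with addable F F∈ (F≢⊤ ∘ cong (true ∷_))
    ... | a , a∉F , F∪a∈ = fsuc a , a∉F ∘ drop-there , F∪a∈

proposition1 : ∀ (n : ℕ) (𝓕 𝓑 : Family n)
    → IsClosureSystem 𝓕 → IsStandard 𝓕 → IsDistributive 𝓕
    → IsNonEmptyAntichain 𝓕 𝓑
    → IsConvexGeometry (extend 𝓕 𝓑) × UniqueMinimalSpanningSets (extend 𝓕 𝓑)
proposition1 n 𝓕 𝓑 cs standard distributive _ =
  convex , ConvexGeometry.uniqueMinimalSpanningSets (extend 𝓕 𝓑) convex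
  where
  convex : IsConvexGeometry (extend 𝓕 𝓑)
  convex = extend-isConvexGeometry 𝓕 𝓑
             (standard∧distributive⇒convexGeometry cs standard distributive)
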